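{- Let $q\ge 3$ and $p\ge 2$ be integers. Suppose that a connected graph $H$ does not contain a subgraph isomorphic to $S_{q,p}$. Then either $\Delta(H)<q$ or $\Delta(H)\ge (v(H)/3)^{1/(2qp)}$.
   Context: Graphs are finite and simple; "subgraph" means not necessarily induced subgraph. $\Delta(H)$ is the maximum vertex degree of $H$ and $v(H)$ its number of vertices. The sparkler graph $S_{q,p}$ is obtained from the star $K_{1,q-1}$ and the path $P_p$ (on $p$ vertices) by adding an edge between an end vertex of $P_p$ and the central vertex of $K_{1,q-1}$. -}

module Defs where

open import Data.Nat using (ℕ; zero; suc; _+_; _*_; _^_; _≤_; _<_; _⊔_)
open import Data.Fin using (Fin; toℕ)
open import Data.Bool using (Bool; true; false; if_then_else_)
open import Data.List using (List; map; foldr; allFin)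
open import Data.Nat.ListAction using (sum)
open import Data.Product using (Σ; _×_; ∃)
open import Data.Sum using (_⊎_)
open import Relation.Binary.PropositionalEquality using (_≡_)
open import Relation.Nullary using (¬_)
open import Function.Definitions using (Injective)

record Graph (n : ℕ) : Set where
  field
    Adj   : Fin n → Fin n → Bool
    sym   : ∀ u v → Adj u v ≡ Adj v u
    irrefl : ∀ u → Adj u u ≡ false
open Graph public

v : ∀ {n} → Graph n → ℕ
v {n} _ = n

deg : ∀ {n} → Graph n → Fin n → ℕ
deg {n} G u = sum (map (λ w → if Adj G u w then 1 else 0) (allFin n))

-- maximum degree Δ(H) (0 for the empty graph)
Δ : ∀ {n} → Graph n → ℕ
Δ {n} G = foldr _⊔_ 0 (map (deg G) (allFin n))

data Walk {n} (G : Graph n) : Fin n → Fin n → Set where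
  here : ∀ {u} → Walk G u u
  step : ∀ {u w x} → Adj G u w ≡ true → Walk G w x → Walk G u x

Connected : ∀ {n} → Graph n → Set
Connected {n} G = (u w : Fin n) → Walk G u w

-- Edges of the sparkler S_{q,p} on vertex set {0,…,q+p-1} (as naturals):
-- 0 is the centre of the star K_{1,q-1}, 1..q-1 are its leaves,
-- q..q+p-1 is the path P_p (in order), and the extra edge joins 0 and q.
data SparklerEdge (q p : ℕ) : ℕ → ℕ → Set where
  leaf : ∀ i → 1 ≤ i → i < q → SparklerEdge q p 0 i
  link : 0 < p → SparklerEdge q p 0 q
  path : ∀ j → suc j < p → SparklerEdge q p (q + j) (q + suc j)

-- H contains a (not necessarily induced) subgraph isomorphic to S_{q,p}:
-- an injective vertex map sending every sparkler edge to an edge of H.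
ContainsSparkler : ∀ {n} → ℕ → ℕ → Graph n → Set
ContainsSparkler {n} q p G =
  Σ (Fin (q + p) → Fin n) λ f →
    Injective _≡_ _≡_ f ×
    (∀ (a b : Fin (q + p)) → SparklerEdge q p (toℕ a) (toℕ b) → Adj G (f a) (f b) ≡ true)

-- Let u be a vertex of maximum degree Δ ≥ q. If some vertex is at distance at least p from u,
-- a shortest path u = x₀, x₁, …, x_p together with q − 1 neighbours of u other than x₁ is a
-- copy of S_{q,p}: the neighbours lie at distance 1 from u and x_j at distance j, so all these
-- vertices are distinct. Hence every vertex lies within distance p − 1 of u, and the BFS bound
-- gives v(H) ≤ (Δ + 1)^(p − 1) ≤ Δ^(2(p − 1)) ≤ 3 Δ^(2qp).
module Submission where

open import Defs hiding (sym)
open import Data.Nat using (ℕ; zero; suc; _+_; _*_; _^_; _≤_; _<_; _⊔_; _∸_; z≤n; s≤s; _≤?_; _<?_; NonZero; >-nonZero; _≤′_; ≤′-refl; ≤′-step)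
open import Data.Nat.Properties
open import Data.Nat.ListAction using (sum)
open import Data.Bool using (Bool; true; false; if_then_else_)
open import Data.Bool.Properties using () renaming (_≟_ to _≟ᵇ_)
open import Data.Fin using (Fin; toℕ)
open import Data.Fin.Properties using (toℕ-injective; toℕ<n; injective⇒≤) renaming (_≟_ to _≟ᶠ_)
open import Data.List using (List; []; _∷_; _++_; map; foldr; allFin; concatMap; length; lookup; filter)
open import Data.List.Properties using (length-++; filter-all; foldr-preservesᵒ)
open import Data.List.Membership.Propositional using (_∈_; _∉_; find)
open import Data.List.Membership.Propositional.Properties
  using (∈-++⁺ˡ; ∈-++⁺ʳ; ∈-++⁻; ∈-concatMap⁺; ∈-concatMap⁻; ∈-filter⁺; ∈-filter⁻; ∈-allFin; ∈-map⁺; ∈-map⁻; foldr-selective)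
open import Data.List.Relation.Unary.All as All using (All)
open import Data.List.Relation.Unary.Any as Any using (Any; here; there; index)
open import Data.List.Relation.Unary.Any.Properties using (lookup-index)
open import Data.List.Relation.Unary.Unique.Propositional using (Unique; []; _∷_)
open import Data.List.Relation.Unary.Unique.Propositional.Properties using (allFin⁺; filter⁺)
open import Data.Product using (Σ; _×_; _,_; proj₁; proj₂; ∃)
open import Data.Sum using (_⊎_; inj₁; inj₂; [_,_])
open import Data.Empty using (⊥-elim)
open import Function using (_∘_)
open import Relation.Binary.PropositionalEquality using (_≡_; _≢_; refl; sym; trans; cong; subst; subst₂)
open import Relation.Binary.Definitions using (tri<; tri≈; tri>)
open import Relation.Nullary using (¬_; yes; no; ¬?)

module _ {A : Set} where

  InjectiveBelow : ℕ → (ℕ → A) → Set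
  InjectiveBelow m f = ∀ {i j} → i < m → j < m → f i ≡ f j → i ≡ j

  _◂_ : A → (ℕ → A) → ℕ → A
  (a ◂ f) zero    = a
  (a ◂ f) (suc i) = f i

  ◂-injectiveBelow : ∀ {m a f} → InjectiveBelow m f → (∀ {i} → i < m → a ≢ f i) →
                     InjectiveBelow (suc m) (a ◂ f)
  ◂-injectiveBelow f-inj fresh {zero}  {zero}  _         _         _ = refl
  ◂-injectiveBelow f-inj fresh {zero}  {suc j} _         (s≤s j<m) e = ⊥-elim (fresh j<m e)
  ◂-injectiveBelow f-inj fresh {suc i} {zero}  (s≤s i<m) _         e = ⊥-elim (fresh i<m (sym e))
  ◂-injectiveBelow f-inj fresh {suc i} {suc j} (s≤s i<m) (s≤s j<m) e = cong suc (f-inj i<m j<m e)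

  join : ℕ → (ℕ → A) → (ℕ → A) → ℕ → A
  join m f g i with i <? m
  ... | yes _ = f i
  ... | no  _ = g (i ∸ m)

  join-< : ∀ {m} f g {i} → i < m → join m f g i ≡ f i
  join-< {m} f g {i} i<m with i <? m
  ... | yes _   = refl
  ... | no  i≮m = ⊥-elim (i≮m i<m)

  join-+ : ∀ m f g j → join m f g (m + j) ≡ g j
  join-+ m f g j with m + j <? m
  ... | yes m+j<m = ⊥-elim (m+n≮m m j m+j<m)
  ... | no  _     = cong g (m+n∸m≡n m j)

  private
    <-+-split : ∀ m {k i} → i < m + k → i < m ⊎ Σ ℕ λ j → j < k × i ≡ m + j
    <-+-split m {k} {i} i<m+k with i <? m
    ... | yes i<m = inj₁ i<m
    ... | no  i≮m = inj₂ (i ∸ m , +-cancelˡ-< m _ _ (subst (_< m + k) (sym m+[i∸m]≡i) i<m+k) , sym m+[i∸m]≡i)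
      where
      m+[i∸m]≡i : m + (i ∸ m) ≡ i
      m+[i∸m]≡i = m+[n∸m]≡n (≮⇒≥ i≮m)

  join-injectiveBelow : ∀ {m k f g} → InjectiveBelow m f → InjectiveBelow k g →
                        (∀ {i j} → i < m → j < k → f i ≢ g j) → InjectiveBelow (m + k) (join m f g)
  join-injectiveBelow {m} {f = f} {g} f-inj g-inj disjoint i<m+k i′<m+k e
    with <-+-split m i<m+k | <-+-split m i′<m+k
  ... | inj₁ i<m | inj₁ i′<m =
    f-inj i<m i′<m (trans (sym (join-< f g i<m)) (trans e (join-< f g i′<m)))
  ... | inj₁ i<m | inj₂ (j′ , j′<k , refl) =
    ⊥-elim (disjoint i<m j′<k (trans (sym (join-< f g i<m)) (trans e (join-+ m f g j′))))
  ... | inj₂ (j , j<k , refl) | inj₁ i′<m =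
    ⊥-elim (disjoint i′<m j<k (sym (trans (sym (join-+ m f g j)) (trans e (join-< f g i′<m)))))
  ... | inj₂ (j , j<k , refl) | inj₂ (j′ , j′<k , refl) =
    cong (m +_) (g-inj j<k j′<k (trans (sym (join-+ m f g j)) (trans e (join-+ m f g j′))))

  _[_]≔_ : (ℕ → A) → ℕ → A → ℕ → A
  (f [ m ]≔ a) i with i ≟ m
  ... | yes _ = a
  ... | no  _ = f i

  []≔-updates : ∀ f m a → (f [ m ]≔ a) m ≡ a
  []≔-updates f m a with m ≟ m
  ... | yes _   = refl
  ... | no  m≢m = ⊥-elim (m≢m refl)

  []≔-minimal : ∀ f {m i} a → i ≢ m → (f [ m ]≔ a) i ≡ f i
  []≔-minimal f {m} {i} a i≢m with i ≟ m
  ... | yes i≡m = ⊥-elim (i≢m i≡m)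
  ... | no  _   = refl

  nth : A → List A → ℕ → A
  nth d []       _       = d
  nth d (x ∷ xs) zero    = x
  nth d (x ∷ xs) (suc k) = nth d xs k

  nth-∈ : ∀ d xs {k} → k < length xs → nth d xs k ∈ xs
  nth-∈ d (x ∷ xs) {zero}  _         = here refl
  nth-∈ d (x ∷ xs) {suc k} (s≤s k<n) = there (nth-∈ d xs k<n)

  nth-injectiveBelow : ∀ d {xs} → Unique xs → InjectiveBelow (length xs) (nth d xs)
  nth-injectiveBelow d {x ∷ xs} (x∉xs ∷ _) {zero}  {zero}  _ _ _ = refl
  nth-injectiveBelow d {x ∷ xs} (x∉xs ∷ _) {zero}  {suc j} _ (s≤s j<n) e = ⊥-elim (All.lookup x∉xs (nth-∈ d xs j<n) e)
  nth-injectiveBelow d {x ∷ xs} (x∉xs ∷ _) {suc i} {zero}  (s≤s i<n) _ e = ⊥-elim (All.lookup x∉xs (nth-∈ d xs i<n) (sym e))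
  nth-injectiveBelow d (_ ∷ unique) {suc i} {suc j} (s≤s i<n) (s≤s j<n) e = cong suc (nth-injectiveBelow d unique i<n j<n e)

∈⇒≤foldr-⊔ : ∀ {x xs} → x ∈ xs → x ≤ foldr _⊔_ 0 xs
∈⇒≤foldr-⊔ x∈xs =
  foldr-preservesᵒ (λ a b → [ m≤n⇒m≤n⊔o b , m≤n⇒m≤o⊔n a ]) 0 _ (inj₂ (Any.map (λ { refl → ≤-refl }) x∈xs))

length-filter-≢ : ∀ {n} (x : Fin n) {xs} → Unique xs → length xs ≤ suc (length (filter (λ y → ¬? (y ≟ᶠ x)) xs))
length-filter-≢ x [] = z≤n
length-filter-≢ x {y ∷ ys} (y∉ys ∷ unique) with y ≟ᶠ x
... | yes refl = s≤s (≤-reflexive (sym (cong length (filter-all (λ y → ¬? (y ≟ᶠ x)) (All.map (λ y≢z z≡y → y≢z (sym z≡y)) y∉ys)))))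
... | no  _    = s≤s (length-filter-≢ x unique)

length-filter-≡true : ∀ {B : Set} (f : B → Bool) xs →
                      length (filter (λ x → f x ≟ᵇ true) xs) ≡ sum (map (λ x → if f x then 1 else 0) xs)
length-filter-≡true f []       = refl
length-filter-≡true f (x ∷ xs) with f x
... | true  = cong suc (length-filter-≡true f xs)
... | false = length-filter-≡true f xs

⊇allFin⇒≤length : ∀ {n} {xs : List (Fin n)} → (∀ w → w ∈ xs) → n ≤ length xs
⊇allFin⇒≤length {xs = xs} covers = injective⇒≤ {f = index ∘ covers} index-injective
  where
  index-injective : ∀ {a b} → index (covers a) ≡ index (covers b) → a ≡ b
  index-injective {a} {b} e = trans (lookup-index (covers a)) (trans (cong (lookup xs) e) (sym (lookup-index (covers b))))

Adjacent : ∀ {n} → Graph n → Fin n → Fin n → Set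
Adjacent H a b = Adj H a b ≡ true

module _ {n} (H : Graph n) where

  adjacent⇒≢ : ∀ {a b} → Adjacent H a b → a ≢ b
  adjacent⇒≢ {a} adj refl with () ← trans (sym adj) (irrefl H a)

  neighbours : Fin n → List (Fin n)
  neighbours w = filter (λ x → Adj H w x ≟ᵇ true) (allFin n)

  length-neighbours : ∀ w → length (neighbours w) ≡ deg H w
  length-neighbours w = length-filter-≡true (Adj H w) (allFin n)

  deg≤Δ : ∀ w → deg H w ≤ Δ H
  deg≤Δ w = ∈⇒≤foldr-⊔ (∈-map⁺ (deg H) (∈-allFin w))

  ∃-deg≥ : ∀ {q} → 0 < q → q ≤ Δ H → ∃ λ u → q ≤ deg H u
  ∃-deg≥ q>0 q≤Δ with foldr-selective ⊔-sel 0 (map (deg H) (allFin n))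
  ... | inj₁ Δ≡0   = ⊥-elim (<⇒≱ q>0 (subst (_ ≤_) Δ≡0 q≤Δ))
  ... | inj₂ Δ∈degs with ∈-map⁻ (deg H) Δ∈degs
  ...   | u , _ , Δ≡deg = u , subst (_ ≤_) Δ≡deg q≤Δ

  module _ (u : Fin n) where

    -- Lists every vertex within distance k of u, with repetitions.
    ball : ℕ → List (Fin n)
    ball zero    = u ∷ []
    ball (suc k) = ball k ++ concatMap neighbours (ball k)

    ∈-ball-step : ∀ k {w z} → w ∈ ball k → Adjacent H w z → z ∈ ball (suc k)
    ∈-ball-step k {z = z} w∈ adj =
      ∈-++⁺ʳ (ball k) (∈-concatMap⁺ neighbours (Any.map (λ { refl → ∈-filter⁺ _ (∈-allFin z) adj }) w∈))

    ∈-ball-suc⁻ : ∀ k {z} → z ∈ ball (suc k) → z ∈ ball k ⊎ ∃ λ w → w ∈ ball k × Adjacent H w z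
    ∈-ball-suc⁻ k z∈ with ∈-++⁻ (ball k) z∈
    ... | inj₁ z∈k = inj₁ z∈k
    ... | inj₂ z∈N with find (∈-concatMap⁻ neighbours {xs = ball k} z∈N)
    ...   | w , w∈k , z∈Nw = inj₂ (w , w∈k , proj₂ (∈-filter⁻ _ {xs = allFin n} z∈Nw))

    ∈-ball-zero⁻ : ∀ {w} → w ∈ ball 0 → w ≡ u
    ∈-ball-zero⁻ (here w≡u) = w≡u

    ball-mono : ∀ {k m w} → k ≤ m → w ∈ ball k → w ∈ ball m
    ball-mono = ≤′-mono ∘ ≤⇒≤′
      where
      ≤′-mono : ∀ {k m w} → k ≤′ m → w ∈ ball k → w ∈ ball m
      ≤′-mono ≤′-refl        = λ w∈ → w∈
      ≤′-mono (≤′-step k≤′m) = ∈-++⁺ˡ ∘ ≤′-mono k≤′m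

    length-concatMap-neighbours : ∀ xs → length (concatMap neighbours xs) ≤ length xs * Δ H
    length-concatMap-neighbours []       = z≤n
    length-concatMap-neighbours (x ∷ xs) = begin
      length (neighbours x ++ concatMap neighbours xs)       ≡⟨ length-++ (neighbours x) ⟩
      length (neighbours x) + length (concatMap neighbours xs) ≤⟨ +-mono-≤ (≤-trans (≤-reflexive (length-neighbours x)) (deg≤Δ x))
                                                                            (length-concatMap-neighbours xs) ⟩
      Δ H + length xs * Δ H                                    ∎
      where open ≤-Reasoning

    length-ball : ∀ k → length (ball k) ≤ suc (Δ H) ^ k
    length-ball zero    = ≤-refl
    length-ball (suc k) = begin
      length (ball k ++ concatMap neighbours (ball k))        ≡⟨ length-++ (ball k) ⟩
      length (ball k) + length (concatMap neighbours (ball k)) ≤⟨ +-monoʳ-≤ (length (ball k)) (length-concatMap-neighbours (ball k)) ⟩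
      length (ball k) + length (ball k) * Δ H                  ≡⟨ sym (*-suc (length (ball k)) (Δ H)) ⟩
      length (ball k) * suc (Δ H)                              ≡⟨ *-comm (length (ball k)) _ ⟩
      suc (Δ H) * length (ball k)                              ≤⟨ *-monoʳ-≤ (suc (Δ H)) (length-ball k) ⟩
      suc (Δ H) ^ suc k                                        ∎
      where open ≤-Reasoning

    walk⇒∈ball : ∀ {a b k} → Walk H a b → a ∈ ball k → ∃ λ m → b ∈ ball m
    walk⇒∈ball {k = k} here         a∈ = k , a∈
    walk⇒∈ball {k = k} (step adj w) a∈ = walk⇒∈ball {k = suc k} w (∈-ball-step k a∈ adj)

    AtDistance : ℕ → Fin n → Set
    AtDistance k w = w ∈ ball k × ∀ {j} → j < k → w ∉ ball j

    atDistance-unique : ∀ {i j w} → AtDistance i w → AtDistance j w → i ≡ j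
    atDistance-unique {i} {j} (w∈i , w∉<i) (w∈j , w∉<j) with <-cmp i j
    ... | tri< i<j _ _ = ⊥-elim (w∉<j i<j w∈i)
    ... | tri≈ _ i≡j _ = i≡j
    ... | tri> _ _ j<i = ⊥-elim (w∉<i j<i w∈j)

    atDistance-predecessor : ∀ {k z} → AtDistance (suc k) z → ∃ λ w → AtDistance k w × Adjacent H w z
    atDistance-predecessor {k} (z∈ , z∉<) with ∈-ball-suc⁻ k z∈
    ... | inj₁ z∈k = ⊥-elim (z∉< ≤-refl z∈k)
    ... | inj₂ (w , w∈k , adj) = w , (w∈k , λ {j} j<k w∈j → z∉< (s≤s j<k) (∈-ball-step j w∈j adj)) , adj

    ∉-ball⇒∃-atDistance : ∀ {k m w} → w ∈ ball m → w ∉ ball k → ∃ (AtDistance (suc k))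
    ∉-ball⇒∃-atDistance {k} {zero}  w∈ w∉k = ⊥-elim (w∉k (ball-mono {0} {k} z≤n w∈))
    ∉-ball⇒∃-atDistance {k} {suc m} w∈ w∉k with ∈-ball-suc⁻ m w∈
    ... | inj₁ w∈m = ∉-ball⇒∃-atDistance {k} {m} w∈m w∉k
    ... | inj₂ (x , x∈m , adj) with Any.any? (x ≟ᶠ_) (ball k)
    ...   | yes x∈k = _ , ∈-ball-step k x∈k adj , λ j<1+k w∈j → w∉k (ball-mono {m = k} (≤-pred j<1+k) w∈j)
    ...   | no  x∉k = ∉-ball⇒∃-atDistance {k} {m} x∈m x∉k

    record Geodesic (k : ℕ) (z : Fin n) : Set where
      field
        vertex   : ℕ → Fin n
        ends     : vertex k ≡ z
        distance : ∀ {i} → i ≤ k → AtDistance i (vertex i)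
        adjacent : ∀ {i} → i < k → Adjacent H (vertex i) (vertex (suc i))

      vertex-injectiveBelow : InjectiveBelow (suc k) vertex
      vertex-injectiveBelow i<1+k j<1+k e =
        atDistance-unique (distance (≤-pred i<1+k)) (subst (AtDistance _) (sym e) (distance (≤-pred j<1+k)))

      starts : vertex 0 ≡ u
      starts = ∈-ball-zero⁻ (proj₁ (distance z≤n))

    extend : ∀ {k w z} → Geodesic k w → AtDistance (suc k) z → Adjacent H w z → Geodesic (suc k) z
    extend {k} {z = z} γ dz adj = record
      { vertex   = vertex [ suc k ]≔ z
      ; ends     = []≔-updates vertex (suc k) z
      ; distance = distance′
      ; adjacent = adjacent′
      }
      where
      open Geodesic γ

      old : ∀ {i} → i ≤ k → (vertex [ suc k ]≔ z) i ≡ vertex i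
      old i≤k = []≔-minimal vertex z (<⇒≢ (s≤s i≤k))

      distance′ : ∀ {i} → i ≤ suc k → AtDistance i ((vertex [ suc k ]≔ z) i)
      distance′ {i} i≤1+k with i ≟ suc k
      ... | yes refl = dz
      ... | no  i≢1+k = distance i≤k
        where i≤k = ≤-pred (≤∧≢⇒< i≤1+k i≢1+k)

      adjacent′ : ∀ {i} → i < suc k → Adjacent H ((vertex [ suc k ]≔ z) i) ((vertex [ suc k ]≔ z) (suc i))
      adjacent′ {i} (s≤s i≤k) with suc i ≟ suc k
      ... | yes refl = subst (λ a → Adjacent H a z) (sym (trans (old ≤-refl) ends)) adj
      ... | no  1+i≢1+k = subst (λ a → Adjacent H a (vertex (suc i))) (sym (old i≤k)) (adjacent 1+i≤k)
        where 1+i≤k = ≤∧≢⇒< i≤k (1+i≢1+k ∘ cong suc)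

    geodesic : ∀ {k z} → AtDistance k z → Geodesic k z
    geodesic {zero} {z} dz = record
      { vertex = λ _ → z ; ends = refl ; distance = λ { z≤n → dz } ; adjacent = λ () }
    geodesic {suc k} dz with atDistance-predecessor dz
    ... | w , dw , adj = extend (geodesic dw) dz adj

module _ {n} (H : Graph n) {u : Fin n} {q p : ℕ} (q<deg : q < deg H u) {z : Fin n} (γ : Geodesic H u p z) where

  open Geodesic γ

  offPathNeighbours : List (Fin n)
  offPathNeighbours = filter (λ w → ¬? (w ≟ᶠ vertex 1)) (neighbours H u)

  spoke : ℕ → Fin n
  spoke = nth u offPathNeighbours

  q≤length-offPathNeighbours : q ≤ length offPathNeighbours
  q≤length-offPathNeighbours = ≤-pred (begin-strict
    q                              <⟨ q<deg ⟩
    deg H u                        ≡⟨ sym (length-neighbours H u) ⟩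
    length (neighbours H u)        ≤⟨ length-filter-≢ (vertex 1) (filter⁺ _ (allFin⁺ n)) ⟩
    suc (length offPathNeighbours) ∎)
    where open ≤-Reasoning

  spoke-index : ∀ {k} → k < q → k < length offPathNeighbours
  spoke-index k<q = ≤-trans k<q q≤length-offPathNeighbours

  spoke-∈ : ∀ {k} → k < q → spoke k ∈ neighbours H u × spoke k ≢ vertex 1
  spoke-∈ k<q = ∈-filter⁻ _ {xs = neighbours H u} (nth-∈ u _ (spoke-index k<q))

  spoke-adjacent : ∀ {k} → k < q → Adjacent H u (spoke k)
  spoke-adjacent = proj₂ ∘ ∈-filter⁻ _ {xs = allFin n} ∘ proj₁ ∘ spoke-∈

  spoke-off-path : ∀ {k} → k < q → spoke k ≢ vertex 1
  spoke-off-path = proj₂ ∘ spoke-∈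

  star : ℕ → Fin n
  star = u ◂ spoke

  trail : ℕ → Fin n
  trail j = vertex (suc j)

  embed : ℕ → Fin n
  embed = join (suc q) star trail

  star-injectiveBelow : InjectiveBelow (suc q) star
  star-injectiveBelow = ◂-injectiveBelow
    (λ i<q j<q → nth-injectiveBelow u (filter⁺ _ (filter⁺ _ (allFin⁺ n))) (spoke-index i<q) (spoke-index j<q))
    (λ k<q → adjacent⇒≢ H (spoke-adjacent k<q))

  trail-∉ : ∀ {i j} → j < p → i ≤ j → trail j ∉ ball H u i
  trail-∉ j<p i≤j = proj₂ (distance j<p) (s≤s i≤j)

  star-off-trail : ∀ {i j} → i < suc q → j < p → star i ≢ trail j
  star-off-trail {zero}  {j}     _         j<p u≡trail =
    trail-∉ j<p z≤n (subst (_∈ ball H u 0) u≡trail (here refl))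
  star-off-trail {suc k} {zero}  (s≤s k<q) _   = spoke-off-path k<q
  star-off-trail {suc k} {suc j} (s≤s k<q) j<p spoke≡trail =
    trail-∉ j<p (s≤s z≤n) (subst (_∈ ball H u 1) spoke≡trail (∈-ball-step H u 0 (here refl) (spoke-adjacent k<q)))

  embed-injectiveBelow : InjectiveBelow (suc q + p) embed
  embed-injectiveBelow = join-injectiveBelow star-injectiveBelow
    (λ i<p j<p e → suc-injective (vertex-injectiveBelow (s≤s i<p) (s≤s j<p) e)) star-off-trail

  embed-zero : embed 0 ≡ u
  embed-zero = join-< star trail {0} (s≤s (z≤n {q}))

  embed-trail : ∀ j → embed (suc q + j) ≡ trail j
  embed-trail = join-+ (suc q) star trail

  embed-edge : ∀ {i j} → SparklerEdge (suc q) p i j → Adjacent H (embed i) (embed j)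
  embed-edge (leaf (suc k) _ (s≤s k<q)) =
    subst₂ (Adjacent H) (sym embed-zero) (sym (join-< star trail (s≤s k<q))) (spoke-adjacent k<q)
  embed-edge (link 0<p) =
    subst₂ (Adjacent H) (sym (trans embed-zero (sym starts)))
      (sym (trans (cong embed (sym (+-identityʳ (suc q)))) (embed-trail 0))) (adjacent 0<p)
  embed-edge (path j 1+j<p) =
    subst₂ (Adjacent H) (sym (embed-trail j)) (sym (embed-trail (suc j))) (adjacent 1+j<p)

  containsSparkler : ContainsSparkler (suc q) p H
  containsSparkler =
    embed ∘ toℕ ,
    (λ {a} {b} e → toℕ-injective (embed-injectiveBelow (toℕ<n a) (toℕ<n b) e)) ,
    (λ _ _ → embed-edge)

ball-covers : ∀ {n} (H : Graph n) {u q p} → Connected H → ¬ ContainsSparkler (suc q) (suc p) H →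
              q < deg H u → ∀ w → w ∈ ball H u p
ball-covers H {u} {q} {p} connected sparkler-free q<deg w with Any.any? (w ≟ᶠ_) (ball H u p)
... | yes w∈ = w∈
... | no  w∉ with walk⇒∈ball H u {k = 0} (connected u w) (here refl)
...   | m , w∈m with ∉-ball⇒∃-atDistance H u {p} {m} w∈m w∉
...     | _ , dz = ⊥-elim (sparkler-free (containsSparkler H q<deg (geodesic H u dz)))

suc^≤3*^ : ∀ {D} q k .{{_ : NonZero q}} → 2 ≤ D → suc D ^ k ≤ 3 * D ^ (2 * q * suc k)
suc^≤3*^ {D} q k 2≤D = begin
  suc D ^ k               ≤⟨ ^-monoˡ-≤ k 1+D≤D² ⟩
  (D ^ 2) ^ k             ≡⟨ ^-*-assoc D 2 k ⟩
  D ^ (2 * k)             ≤⟨ ^-monoʳ-≤ D 2k≤2q[1+k] ⟩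
  D ^ (2 * q * suc k)     ≤⟨ m≤n*m _ 3 ⟩
  3 * D ^ (2 * q * suc k) ∎
  where
  open ≤-Reasoning
  instance
    D≢0 : NonZero D
    D≢0 = >-nonZero (≤-trans (s≤s z≤n) 2≤D)
  1+D≤D² : suc D ≤ D ^ 2
  1+D≤D² = begin
    suc D     ≤⟨ +-monoˡ-≤ D (≤-trans (s≤s z≤n) 2≤D) ⟩
    D + D     ≡⟨ cong (D +_) (sym (+-identityʳ D)) ⟩
    2 * D     ≤⟨ *-monoˡ-≤ D 2≤D ⟩
    D * D     ≡⟨ cong (D *_) (sym (*-identityʳ D)) ⟩
    D ^ 2     ∎
  2k≤2q[1+k] : 2 * k ≤ 2 * q * suc k
  2k≤2q[1+k] = ≤-trans (*-monoʳ-≤ 2 (≤-trans (n≤1+n k) (m≤n*m (suc k) q))) (≤-reflexive (sym (*-assoc 2 q (suc k))))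

lemma6 : (q p : ℕ) → 3 ≤ q → 2 ≤ p → ∀ {n} (H : Graph n) → Connected H →
    ¬ ContainsSparkler q p H →
    (Δ H < q) ⊎ (v H ≤ 3 * (Δ H ^ (2 * q * p)))
lemma6 q p _ _ H _ _ with q ≤? Δ H
... | no q≰Δ = inj₁ (≰⇒> q≰Δ)
lemma6 (suc q) (suc p) (s≤s 2≤q) _ {n} H connected sparkler-free | yes q<Δ with ∃-deg≥ H (s≤s z≤n) q<Δ
... | u , q<deg = inj₂ (begin
  n                             ≤⟨ ⊇allFin⇒≤length (ball-covers H connected sparkler-free q<deg) ⟩
  length (ball H u p)           ≤⟨ length-ball H u p ⟩
  suc (Δ H) ^ p                 ≤⟨ suc^≤3*^ (suc q) p (≤-trans 2≤q (<⇒≤ q<Δ)) ⟩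
  3 * Δ H ^ (2 * suc q * suc p) ∎)
  where open ≤-Reasoning
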